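{- Let $n \geq 1$, $\ell \geq 1$ and $m_1 \geq m_2 \geq \dots \geq m_\ell \geq 1$ be integers. Define $b_0 = 2^n - 1$ and, for $j = 1, \dots, \ell$, $b_j = 2^{m_{\ell - j + 1}} b_{j-1} + 1$ (so $b_\ell = 2^{m_1}(2^{m_2}(\cdots(2^{m_\ell}(2^n - 1) + 1)\cdots) + 1) + 1$). Then $$M(K_{1(n), m_\ell, m_{\ell-1}, \dots, m_1}) = M(O_{m_1} \vee O_{m_2} \vee \dots \vee O_{m_\ell} \vee K_n) \geq b_\ell.$$
   Context: All graphs are finite and simple. For a connected graph $G$, a coloring of $G$ is a function $f: V(G) \to \mathbb{N}$ (positive integers); for a subgraph $H$, $f(H) = \sum_{v \in V(H)} f(v)$. $f$ is an IC-coloring if for every integer $k \in \{1, \dots, f(G)\}$ there is an induced connected subgraph $H$ of $G$ with $f(H) = k$. The IC-index $M(G)$ is the maximum of $f(G)$ over all IC-colorings $f$ of $G$. $O_m$ is the edgeless graph on $m$ vertices, $K_n$ the complete graph on $n$ vertices, and $H_0 \vee H_1$ denotes the join (disjoint union plus all edges between $V(H_0)$ and $V(H_1)$); the iterated join is $O_{m_1} \vee (O_{m_2} \vee (\cdots \vee (O_{m_\ell} \vee K_n)))$. $K_{1(n), m_\ell, \dots, m_1}$ denotes the complete multipartite graph with $n$ partite sets of size one and further partite sets of sizes $m_\ell, \dots, m_1$ (no edges within a partite set, all edges between different partite sets). -}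

module Defs where

open import Data.Nat using (ℕ; zero; suc; _+_; _*_; _∸_; _^_; _≤_; _≥_)
open import Data.Fin using (Fin; splitAt)
open import Data.Fin.Subset using (Subset; _∈_)
open import Data.Vec using (Vec; lookup; tabulate)
open import Data.Vec using () renaming (sum to vsum)
open import Data.List using (List; []; _∷_; replicate; reverse; _++_; foldr)
open import Data.List.Relation.Unary.All using (All)
open import Data.List.Relation.Unary.Linked using (Linked)
open import Data.Sum using (_⊎_; inj₁; inj₂)
open import Data.Product using (Σ; ∃; _×_; _,_)
open import Data.Unit using (⊤)
open import Data.Empty using (⊥)
open import Data.Bool using (if_then_else_)
open import Relation.Nullary using (¬_)
open import Relation.Binary.PropositionalEquality using (_≡_; _≢_)

record Graph : Set₁ where
  field
    N   : ℕ
    Adj : Fin N → Fin N → Set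
open Graph public

O : ℕ → Graph
O m = record { N = m ; Adj = λ _ _ → ⊥ }

K : ℕ → Graph
K n = record { N = n ; Adj = λ i j → i ≢ j }

joinAdj : (G H : Graph) → Fin (N G + N H) → Fin (N G + N H) → Set
joinAdj G H i j with splitAt (N G) i | splitAt (N G) j
... | inj₁ a | inj₁ b = Adj G a b
... | inj₂ a | inj₂ b = Adj H a b
... | inj₁ _ | inj₂ _ = ⊤
... | inj₂ _ | inj₁ _ = ⊤

_∨G_ : Graph → Graph → Graph
G ∨G H = record { N = N G + N H ; Adj = joinAdj G H }

-- Iterated join O_{m₁} ∨ (O_{m₂} ∨ (⋯ ∨ (O_{m_ℓ} ∨ K_n))) for ms = [m₁, …, m_ℓ]
iterJoin : List ℕ → ℕ → Graph
iterJoin ms n = foldr (λ m G → O m ∨G G) (K n) ms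

sumL : List ℕ → ℕ
sumL = foldr _+_ 0

partOf : (ps : List ℕ) → Fin (sumL ps) → ℕ
partOf [] ()
partOf (p ∷ ps) i with splitAt p i
... | inj₁ _ = 0
... | inj₂ j = suc (partOf ps j)

completeMultipartite : List ℕ → Graph
completeMultipartite ps =
  record { N = sumL ps ; Adj = λ i j → partOf ps i ≢ partOf ps j }

-- K_{1(n), m_ℓ, …, m_1} for ms = [m₁, …, m_ℓ]
Kmulti : ℕ → List ℕ → Graph
Kmulti n ms = completeMultipartite (replicate n 1 ++ reverse ms)

data WalkIn (G : Graph) (S : Subset (N G)) : Fin (N G) → Fin (N G) → Set where
  here : ∀ {u} → u ∈ S → WalkIn G S u u
  step : ∀ {u w v} → u ∈ S → Adj G u w → WalkIn G S w v → WalkIn G S u v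

ConnectedInduced : (G : Graph) → Subset (N G) → Set
ConnectedInduced G S =
  (∃ λ v → v ∈ S) × (∀ u v → u ∈ S → v ∈ S → WalkIn G S u v)

weight : (G : Graph) → (Fin (N G) → ℕ) → Subset (N G) → ℕ
weight G f S = vsum (tabulate (λ i → if lookup S i then f i else 0))

total : (G : Graph) → (Fin (N G) → ℕ) → ℕ
total G f = vsum (tabulate f)

IsICColoring : (G : Graph) → (Fin (N G) → ℕ) → Set
IsICColoring G f =
  (∀ v → 1 ≤ f v) ×
  (∀ k → 1 ≤ k → k ≤ total G f →
     ∃ λ (S : Subset (N G)) → ConnectedInduced G S × weight G f S ≡ k)

IsICIndex : Graph → ℕ → Set
IsICIndex G k =
  (∃ λ f → IsICColoring G f × total G f ≡ k) ×
  (∀ f → IsICColoring G f → total G f ≤ k)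

-- b_ℓ for ms = [m₁, …, m_ℓ]: b(m ∷ rest) = 2^m * b(rest) + 1, b([]) = 2^n - 1
bval : ℕ → List ℕ → ℕ
bval n [] = 2 ^ n ∸ 1
bval n (m ∷ ms) = 2 ^ m * bval n ms + 1

-- Both graphs are obtained from each other by relabelling vertices: joins are associative
-- and commutative up to isomorphism, K_{1(n)} is K_n, and a complete multipartite graph is
-- the join of the edgeless graphs on its parts.  The IC-index is invariant under isomorphism,
-- and it exists: an IC-colouring has total at most 2^|V| (the realising subsets of 1, 2, …
-- are pairwise distinct), a colouring of total t takes values ≤ t, and being an IC-colouring
-- is decidable because connected induced subgraphs of a complete multipartite graph have
-- diameter at most two.
--
-- K_n is IC-coloured by 1, 2, …, 2^(n-1), of total
-- 2^n - 1.  If H has an IC-colouring g of total b, colour O_{m+1} ∨ H by 1, 2b, 4b, …, 2^m b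
-- on O_{m+1} and by 2g on H; the total is 2^(m+1) b + 1.  Every k ≥ 2 up to that total is
-- ε + 2(s b + r + 1) with ε ∈ {0, 1}, r < b and s < 2^m, and is realised by the vertex of
-- colour 1 (if ε = 1), the binary expansion of s among the vertices of colours 2b, …, 2^m b,
-- and a connected subgraph of H of g-weight r + 1; in a join, any set whose H-part induces a
-- connected subgraph of H is connected.
module Submission where

open import Defs
open import Level using (0ℓ)
open import Data.Bool using (Bool; true; false; if_then_else_)
open import Data.Empty using (⊥-elim)
open import Data.Fin using (Fin; zero; suc; toℕ; fromℕ<; _↑ˡ_; _↑ʳ_; splitAt; join; finToFun; funToFin)
import Data.Fin.Properties as Finₚ
open import Data.Fin.Subset using (Subset; _∈_; ⁅_⁆; Nonempty) renaming (⊥ to ∅)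
open import Data.Fin.Subset.Properties using (_∈?_; nonempty?; Empty-unique; anySubset?; x∈⁅x⁆; x∈⁅y⁆⇒x≡y)
open import Data.List using (List; []; _∷_; [_]; _++_; reverse; replicate)
open import Data.List.Properties using (unfold-reverse)
open import Data.List.Relation.Unary.All using (All; _∷_)
open import Data.List.Relation.Unary.Linked using (Linked)
open import Data.Nat using (ℕ; zero; suc; _+_; _*_; _^_; _∸_; _≤_; _<_; _≥_; z≤n; s≤s; _≤?_; NonZero; >-nonZero)
open import Data.Nat.DivMod using (_/_; _%_; m%n<n; m≡m%n+[m/n]*n; m<n*o⇒m/o<n)
open import Data.Nat.Properties
open import Data.Nat.Tactic.RingSolver using (solve-∀)
open import Data.Product using (∃; ∃₂; _×_; _,_; proj₁; proj₂)
open import Data.Sum using (_⊎_; inj₁; inj₂; swap)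
import Data.Sum as Sum
open import Data.Sum.Algebra using (⊎-assoc)
open import Data.Sum.Function.Propositional using (_⊎-↔_)
open import Data.Sum.Properties using (swap-↔)
open import Data.Unit using (⊤; tt)
open import Data.Vec using ([]; _∷_; there; tabulate; lookup) renaming (_++_ to _++ᵛ_; sum to vsum)
open import Data.Vec.Properties
  using (tabulate-cong; tabulate∘lookup; lookup∘tabulate; []=⇒lookup; lookup⇒[]=; lookup-++ˡ; lookup-++ʳ)
open import Data.Vec.Functional using () renaming (_++_ to _++ᶠ_)
import Data.Vec.Functional.Properties as Vecᶠ
open import Function using (id; _∘_; Injective)
open import Function.Bundles using (_↔_; Inverse)
open import Function.Properties.Inverse using (↔-refl; ↔-sym; ↔-trans)
open import Relation.Binary.Core using (Rel)
open import Relation.Binary.PropositionalEquality hiding ([_])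
open import Relation.Nullary using (Dec; yes; no; ¬_; ¬?; contradiction)
open import Relation.Nullary.Decidable using (map′; _×-dec_; _⊎-dec_; _→-dec_; decidable-stable)

import Algebra.Properties.CommutativeMonoid.Sum +-0-commutativeMonoid as ℕ-Sum

∑ : ∀ {n} → (Fin n → ℕ) → ℕ
∑ f = vsum (tabulate f)

restrict : ∀ {n} → Subset n → (Fin n → ℕ) → Fin n → ℕ
restrict S f i = if lookup S i then f i else 0

∑-cong : ∀ {n} {f g : Fin n → ℕ} → f ≗ g → ∑ f ≡ ∑ g
∑-cong = cong vsum ∘ tabulate-cong

∑-restrict-cong : ∀ {n} (S : Subset n) {f g : Fin n → ℕ} → f ≗ g → ∑ (restrict S f) ≡ ∑ (restrict S g)
∑-restrict-cong S f≗g = ∑-cong λ i → cong (if lookup S i then_else 0) (f≗g i)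

∑-++ : ∀ m {n} (f : Fin (m + n) → ℕ) → ∑ f ≡ ∑ (f ∘ (_↑ˡ n)) + ∑ (f ∘ (m ↑ʳ_))
∑-++ zero    f = refl
∑-++ (suc m) f = trans (cong (f zero +_) (∑-++ m (f ∘ suc))) (sym (+-assoc (f zero) _ _))

∑-++ᶠ : ∀ {m n} (f : Fin m → ℕ) (g : Fin n → ℕ) → ∑ (f ++ᶠ g) ≡ ∑ f + ∑ g
∑-++ᶠ {m} f g =
  trans (∑-++ m (f ++ᶠ g)) (cong₂ _+_ (∑-cong (Vecᶠ.lookup-++ˡ f g)) (∑-cong (Vecᶠ.lookup-++ʳ f g)))

∑-restrict-++ : ∀ {m n} (S : Subset m) (T : Subset n) (f : Fin m → ℕ) (g : Fin n → ℕ) →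
  ∑ (restrict (S ++ᵛ T) (f ++ᶠ g)) ≡ ∑ (restrict S f) + ∑ (restrict T g)
∑-restrict-++ {m} S T f g = trans (∑-++ m _) (cong₂ _+_
  (∑-cong λ i → cong₂ (if_then_else 0) (lookup-++ˡ S T i) (Vecᶠ.lookup-++ˡ f g i))
  (∑-cong λ j → cong₂ (if_then_else 0) (lookup-++ʳ S T j) (Vecᶠ.lookup-++ʳ f g j)))

∑-*ˡ : ∀ {n} c (f : Fin n → ℕ) → ∑ (λ i → c * f i) ≡ c * ∑ f
∑-*ˡ {zero}  c f = sym (*-zeroʳ c)
∑-*ˡ {suc n} c f = trans (cong (c * f zero +_) (∑-*ˡ c (f ∘ suc))) (sym (*-distribˡ-+ c (f zero) _))

∑-restrict-*ˡ : ∀ {n} c (S : Subset n) (f : Fin n → ℕ) →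
  ∑ (restrict S (λ i → c * f i)) ≡ c * ∑ (restrict S f)
∑-restrict-*ˡ c S f = trans (∑-cong λ i → if-* (lookup S i) (f i)) (∑-*ˡ c (restrict S f))
  where
  if-* : ∀ b x → (if b then c * x else 0) ≡ c * (if b then x else 0)
  if-* true  x = refl
  if-* false x = sym (*-zeroʳ c)

∑-restrict-∅ : ∀ {n} (f : Fin n → ℕ) → ∑ (restrict ∅ f) ≡ 0
∑-restrict-∅ {zero}  f = refl
∑-restrict-∅ {suc n} f = ∑-restrict-∅ (f ∘ suc)

∑-restrict-⁅⁆ : ∀ {n} (f : Fin n → ℕ) i → ∑ (restrict ⁅ i ⁆ f) ≡ f i
∑-restrict-⁅⁆ f zero    = trans (cong (f zero +_) (∑-restrict-∅ (f ∘ suc))) (+-identityʳ (f zero))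
∑-restrict-⁅⁆ f (suc i) = ∑-restrict-⁅⁆ (f ∘ suc) i

0<∑-restrict⇒Nonempty : ∀ {n} (S : Subset n) (f : Fin n → ℕ) → 0 < ∑ (restrict S f) → Nonempty S
0<∑-restrict⇒Nonempty S f 0<∑ with nonempty? S
... | yes S-ne = S-ne
... | no  S-empty =
  contradiction (trans (cong (λ T → ∑ (restrict T f)) (Empty-unique S-empty)) (∑-restrict-∅ f)) (>⇒≢ 0<∑)

f≤∑ : ∀ {n} (f : Fin n → ℕ) i → f i ≤ ∑ f
f≤∑ f zero    = m≤m+n (f zero) _
f≤∑ f (suc i) = ≤-trans (f≤∑ (f ∘ suc) i) (m≤n+m _ (f zero))

∑≡sum : ∀ {n} (f : Fin n → ℕ) → ∑ f ≡ ℕ-Sum.sum f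
∑≡sum {zero}  f = refl
∑≡sum {suc n} f = cong (f zero +_) (∑≡sum (f ∘ suc))

∑-↔ : ∀ {m n} (π : Fin m ↔ Fin n) (f : Fin n → ℕ) → ∑ (f ∘ Inverse.to π) ≡ ∑ f
∑-↔ π f = trans (∑≡sum (f ∘ Inverse.to π)) (trans (sym (ℕ-Sum.sum-permute f π)) (sym (∑≡sum f)))

powersOfTwo : ∀ {n} → Fin n → ℕ
powersOfTwo i = 2 ^ toℕ i

suc-∑-powersOfTwo : ∀ n → suc (∑ (powersOfTwo {n})) ≡ 2 ^ n
suc-∑-powersOfTwo zero    = refl
suc-∑-powersOfTwo (suc n) = begin
  2 + ∑ (λ i → 2 * powersOfTwo {n} i) ≡⟨ cong (2 +_) (∑-*ˡ 2 (powersOfTwo {n})) ⟩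
  2 + 2 * ∑ (powersOfTwo {n})          ≡⟨ *-distribˡ-+ 2 1 (∑ (powersOfTwo {n})) ⟨
  2 * suc (∑ (powersOfTwo {n}))        ≡⟨ cong (2 *_) (suc-∑-powersOfTwo n) ⟩
  2 * 2 ^ n                            ∎
  where open ≡-Reasoning

bit : Bool → ℕ
bit b = if b then 1 else 0

halve : ∀ k → ∃₂ λ ε q → k ≡ bit ε + 2 * q
halve zero = false , 0 , refl
halve (suc k) with halve k
... | false , q , refl = true , q , refl
... | true  , q , refl = false , suc q , sym (*-suc 2 q)

halve-≤ : ∀ ε q X → bit ε + 2 * q ≤ 2 * X + 1 → q ≤ X
halve-≤ ε q X ≤2X+1 = ≤-pred (*-cancelˡ-< 2 q (suc X) (begin-strict
  2 * q          ≤⟨ m≤n+m (2 * q) (bit ε) ⟩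
  bit ε + 2 * q  ≤⟨ ≤2X+1 ⟩
  2 * X + 1      ≡⟨ +-comm (2 * X) 1 ⟩
  suc (2 * X)    <⟨ n<1+n (suc (2 * X)) ⟩
  2 + 2 * X      ≡⟨ *-suc 2 X ⟨
  2 * suc X      ∎))
  where open ≤-Reasoning

binary-expansion : ∀ {n} s → s < 2 ^ n → ∃ λ S → ∑ (restrict S (powersOfTwo {n})) ≡ s
binary-expansion {zero}  zero    _          = [] , refl
binary-expansion {zero}  (suc _) (s≤s ())
binary-expansion {suc n} s s<2^[1+n] with halve s
... | ε , q , refl with binary-expansion {n} q q<2^n
  where
  q<2^n : q < 2 ^ n
  q<2^n = *-cancelˡ-< 2 q (2 ^ n) (≤-<-trans (m≤n+m (2 * q) (bit ε)) s<2^[1+n])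
... | S , ∑S≡q = ε ∷ S , cong (bit ε +_) (trans (∑-restrict-*ˡ 2 S powersOfTwo) (cong (2 *_) ∑S≡q))

record _≅ᴿ_ {X Y : Set} (A : Rel X 0ℓ) (B : Rel Y 0ℓ) : Set where
  field
    bijection : X ↔ Y
  open Inverse bijection public using (to; from; strictlyInverseˡ; strictlyInverseʳ)
  field
    to-adj   : ∀ {x x′} → A x x′ → B (to x) (to x′)
    from-adj : ∀ {y y′} → B y y′ → A (from y) (from y′)

module _ {X Y : Set} {A : Rel X 0ℓ} {B : Rel Y 0ℓ} (π : X ↔ Y) where
  open Inverse π

  mk≅ᴿ : (∀ {x x′} → A x x′ → B (to x) (to x′)) →
         (∀ {x x′} → B (to x) (to x′) → A x x′) → A ≅ᴿ B
  mk≅ᴿ to-adj reflect = record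
    { bijection = π
    ; to-adj    = to-adj
    ; from-adj  = λ {y} {y′} b → reflect (subst₂ B (sym (strictlyInverseˡ y)) (sym (strictlyInverseˡ y′)) b)
    }

≅ᴿ-refl : ∀ {X} {A : Rel X 0ℓ} → A ≅ᴿ A
≅ᴿ-refl = record { bijection = ↔-refl ; to-adj = id ; from-adj = id }

≅ᴿ-sym : ∀ {X Y} {A : Rel X 0ℓ} {B : Rel Y 0ℓ} → A ≅ᴿ B → B ≅ᴿ A
≅ᴿ-sym i = record { bijection = ↔-sym bijection ; to-adj = from-adj ; from-adj = to-adj }
  where open _≅ᴿ_ i

≅ᴿ-trans : ∀ {X Y Z} {A : Rel X 0ℓ} {B : Rel Y 0ℓ} {C : Rel Z 0ℓ} → A ≅ᴿ B → B ≅ᴿ C → A ≅ᴿ C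
≅ᴿ-trans i j = record
  { bijection = ↔-trans I.bijection J.bijection
  ; to-adj    = J.to-adj ∘ I.to-adj
  ; from-adj  = I.from-adj ∘ J.from-adj
  }
  where
  module I = _≅ᴿ_ i
  module J = _≅ᴿ_ j

_∨ᴿ_ : {X Y : Set} → Rel X 0ℓ → Rel Y 0ℓ → Rel (X ⊎ Y) 0ℓ
(A ∨ᴿ B) (inj₁ x) (inj₁ x′) = A x x′
(A ∨ᴿ B) (inj₂ y) (inj₂ y′) = B y y′
(A ∨ᴿ B) _        _         = ⊤

module _ {X X′ Y Y′ : Set} {A : Rel X 0ℓ} {A′ : Rel X′ 0ℓ} {B : Rel Y 0ℓ} {B′ : Rel Y′ 0ℓ} where

  ∨ᴿ-map : ∀ (f : X → X′) (g : Y → Y′) →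
    (∀ {x x′} → A x x′ → A′ (f x) (f x′)) → (∀ {y y′} → B y y′ → B′ (g y) (g y′)) →
    ∀ s t → (A ∨ᴿ B) s t → (A′ ∨ᴿ B′) (Sum.map f g s) (Sum.map f g t)
  ∨ᴿ-map f g f-adj g-adj (inj₁ _) (inj₁ _) a = f-adj a
  ∨ᴿ-map f g f-adj g-adj (inj₁ _) (inj₂ _) _ = tt
  ∨ᴿ-map f g f-adj g-adj (inj₂ _) (inj₁ _) _ = tt
  ∨ᴿ-map f g f-adj g-adj (inj₂ _) (inj₂ _) b = g-adj b

module _ {X X′ Y Y′ : Set} {A : Rel X 0ℓ} {A′ : Rel X′ 0ℓ} {B : Rel Y 0ℓ} {B′ : Rel Y′ 0ℓ} where

  ∨ᴿ-cong : A ≅ᴿ A′ → B ≅ᴿ B′ → (A ∨ᴿ B) ≅ᴿ (A′ ∨ᴿ B′)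
  ∨ᴿ-cong i j = record
    { bijection = I.bijection ⊎-↔ J.bijection
    ; to-adj    = λ {s} {t} → ∨ᴿ-map I.to J.to I.to-adj J.to-adj s t
    ; from-adj  = λ {s} {t} → ∨ᴿ-map I.from J.from I.from-adj J.from-adj s t
    }
    where
    module I = _≅ᴿ_ i
    module J = _≅ᴿ_ j

∨ᴿ-swap : ∀ {X Y} {A : Rel X 0ℓ} {B : Rel Y 0ℓ} s t → (A ∨ᴿ B) s t → (B ∨ᴿ A) (swap s) (swap t)
∨ᴿ-swap (inj₁ _) (inj₁ _) a = a
∨ᴿ-swap (inj₁ _) (inj₂ _) a = a
∨ᴿ-swap (inj₂ _) (inj₁ _) a = a
∨ᴿ-swap (inj₂ _) (inj₂ _) a = a

∨ᴿ-comm : ∀ {X Y} {A : Rel X 0ℓ} {B : Rel Y 0ℓ} → (A ∨ᴿ B) ≅ᴿ (B ∨ᴿ A)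
∨ᴿ-comm = record
  { bijection = swap-↔
  ; to-adj    = λ {s} {t} → ∨ᴿ-swap s t
  ; from-adj  = λ {s} {t} → ∨ᴿ-swap s t
  }

module _ {X Y Z : Set} {A : Rel X 0ℓ} {B : Rel Y 0ℓ} {C : Rel Z 0ℓ} where
  open Inverse (⊎-assoc 0ℓ X Y Z)

  ∨ᴿ-assoc : ((A ∨ᴿ B) ∨ᴿ C) ≅ᴿ (A ∨ᴿ (B ∨ᴿ C))
  ∨ᴿ-assoc = record
    { bijection = ⊎-assoc 0ℓ X Y Z
    ; to-adj    = λ {s} {t} → to-adj s t
    ; from-adj  = λ {s} {t} → from-adj s t
    }
    where
    to-adj : ∀ s t → ((A ∨ᴿ B) ∨ᴿ C) s t → (A ∨ᴿ (B ∨ᴿ C)) (to s) (to t)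
    to-adj (inj₁ (inj₁ _)) (inj₁ (inj₁ _)) a = a
    to-adj (inj₁ (inj₁ _)) (inj₁ (inj₂ _)) a = a
    to-adj (inj₁ (inj₁ _)) (inj₂ _)        a = a
    to-adj (inj₁ (inj₂ _)) (inj₁ (inj₁ _)) a = a
    to-adj (inj₁ (inj₂ _)) (inj₁ (inj₂ _)) a = a
    to-adj (inj₁ (inj₂ _)) (inj₂ _)        a = a
    to-adj (inj₂ _)        (inj₁ (inj₁ _)) a = a
    to-adj (inj₂ _)        (inj₁ (inj₂ _)) a = a
    to-adj (inj₂ _)        (inj₂ _)        a = a
    from-adj : ∀ s t → (A ∨ᴿ (B ∨ᴿ C)) s t → ((A ∨ᴿ B) ∨ᴿ C) (from s) (from t)
    from-adj (inj₁ _)        (inj₁ _)        a = a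
    from-adj (inj₁ _)        (inj₂ (inj₁ _)) a = a
    from-adj (inj₁ _)        (inj₂ (inj₂ _)) a = a
    from-adj (inj₂ (inj₁ _)) (inj₁ _)        a = a
    from-adj (inj₂ (inj₁ _)) (inj₂ (inj₁ _)) a = a
    from-adj (inj₂ (inj₁ _)) (inj₂ (inj₂ _)) a = a
    from-adj (inj₂ (inj₂ _)) (inj₁ _)        a = a
    from-adj (inj₂ (inj₂ _)) (inj₂ (inj₁ _)) a = a
    from-adj (inj₂ (inj₂ _)) (inj₂ (inj₂ _)) a = a

module _ (G H : Graph) where

  joinAdj-splitAt : ∀ i j → joinAdj G H i j ≡ (Adj G ∨ᴿ Adj H) (splitAt (N G) i) (splitAt (N G) j)
  joinAdj-splitAt i j with splitAt (N G) i | splitAt (N G) j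
  ... | inj₁ _ | inj₁ _ = refl
  ... | inj₁ _ | inj₂ _ = refl
  ... | inj₂ _ | inj₁ _ = refl
  ... | inj₂ _ | inj₂ _ = refl

  ∨G≅ᴿ∨ᴿ : Adj (G ∨G H) ≅ᴿ (Adj G ∨ᴿ Adj H)
  ∨G≅ᴿ∨ᴿ = mk≅ᴿ Finₚ.+↔⊎ (λ {i} {j} → subst id (joinAdj-splitAt i j))
                          (λ {i} {j} → subst id (sym (joinAdj-splitAt i j)))

-- Wrapped in a record indexed by the graphs, so that Agda can infer them (Adj is not injective).
record _≅_ (G H : Graph) : Set where
  constructor mk≅
  field
    adjacency : Adj G ≅ᴿ Adj H
  open _≅ᴿ_ adjacency public

≅-refl : ∀ {G} → G ≅ G
≅-refl = mk≅ ≅ᴿ-refl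

≅-sym : ∀ {G H} → G ≅ H → H ≅ G
≅-sym (mk≅ i) = mk≅ (≅ᴿ-sym i)

≅-trans : ∀ {G H K} → G ≅ H → H ≅ K → G ≅ K
≅-trans (mk≅ i) (mk≅ j) = mk≅ (≅ᴿ-trans i j)

≅-reflexive : ∀ {G H} → G ≡ H → G ≅ H
≅-reflexive refl = ≅-refl

module ≅-Reasoning where
  infix  1 begin_
  infixr 2 _≅⟨_⟩_
  infix  3 _∎

  begin_ : ∀ {G H} → G ≅ H → G ≅ H
  begin G≅H = G≅H

  _≅⟨_⟩_ : ∀ G {H K} → G ≅ H → H ≅ K → G ≅ K
  _ ≅⟨ G≅H ⟩ H≅K = ≅-trans G≅H H≅K

  _∎ : ∀ G → G ≅ G
  _ ∎ = ≅-refl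

∨G-cong : ∀ {G G′ H H′} → G ≅ G′ → H ≅ H′ → (G ∨G H) ≅ (G′ ∨G H′)
∨G-cong {G} {G′} {H} {H′} (mk≅ i) (mk≅ j) =
  mk≅ (≅ᴿ-trans (∨G≅ᴿ∨ᴿ G H) (≅ᴿ-trans (∨ᴿ-cong i j) (≅ᴿ-sym (∨G≅ᴿ∨ᴿ G′ H′))))

∨G-congˡ : ∀ {G G′} → G ≅ G′ → ∀ H → (G ∨G H) ≅ (G′ ∨G H)
∨G-congˡ G≅G′ H = ∨G-cong G≅G′ (≅-refl {H})

∨G-congʳ : ∀ G {H H′} → H ≅ H′ → (G ∨G H) ≅ (G ∨G H′)
∨G-congʳ G = ∨G-cong (≅-refl {G})

∨G-comm : ∀ G H → (G ∨G H) ≅ (H ∨G G)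
∨G-comm G H = mk≅ (≅ᴿ-trans (∨G≅ᴿ∨ᴿ G H) (≅ᴿ-trans ∨ᴿ-comm (≅ᴿ-sym (∨G≅ᴿ∨ᴿ H G))))

∨G-assoc : ∀ G H K → ((G ∨G H) ∨G K) ≅ (G ∨G (H ∨G K))
∨G-assoc G H K = mk≅ (≅ᴿ-trans (∨G≅ᴿ∨ᴿ (G ∨G H) K)
  (≅ᴿ-trans (∨ᴿ-cong (∨G≅ᴿ∨ᴿ G H) ≅ᴿ-refl)
  (≅ᴿ-trans ∨ᴿ-assoc
  (≅ᴿ-trans (∨ᴿ-cong ≅ᴿ-refl (≅ᴿ-sym (∨G≅ᴿ∨ᴿ H K)))
            (≅ᴿ-sym (∨G≅ᴿ∨ᴿ G (H ∨G K)))))))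

CM : List ℕ → Graph
CM = completeMultipartite

CM-cons : ∀ p ps → CM (p ∷ ps) ≅ (O p ∨G CM ps)
CM-cons p ps = mk≅ (mk≅ᴿ ↔-refl (λ {i} {j} → to-adj i j) (λ {i} {j} → reflect i j))
  where
  to-adj : ∀ i j → Adj (CM (p ∷ ps)) i j → Adj (O p ∨G CM ps) i j
  to-adj i j i≁j with splitAt p i | splitAt p j
  ... | inj₁ _ | inj₁ _ = i≁j refl
  ... | inj₁ _ | inj₂ _ = tt
  ... | inj₂ _ | inj₁ _ = tt
  ... | inj₂ _ | inj₂ _ = i≁j ∘ cong suc
  reflect : ∀ i j → Adj (O p ∨G CM ps) i j → Adj (CM (p ∷ ps)) i j
  reflect i j i~j with splitAt p i | splitAt p j
  ... | inj₁ _ | inj₁ _ = ⊥-elim i~j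
  ... | inj₁ _ | inj₂ _ = λ ()
  ... | inj₂ _ | inj₁ _ = λ ()
  ... | inj₂ _ | inj₂ _ = i~j ∘ suc-injective

O₁∨K≅K : ∀ n → (O 1 ∨G K n) ≅ K (suc n)
O₁∨K≅K n = mk≅ (mk≅ᴿ ↔-refl (λ {i} {j} → to-adj i j) (λ {i} {j} → reflect i j))
  where
  to-adj : ∀ i j → Adj (O 1 ∨G K n) i j → i ≢ j
  to-adj zero    zero    ()
  to-adj zero    (suc _) _   ()
  to-adj (suc _) zero    _   ()
  to-adj (suc _) (suc _) i≢j = i≢j ∘ Finₚ.suc-injective
  reflect : ∀ i j → i ≢ j → Adj (O 1 ∨G K n) i j
  reflect zero    zero    i≢j = i≢j refl
  reflect zero    (suc _) _   = tt
  reflect (suc _) zero    _   = tt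
  reflect (suc _) (suc _) i≢j = i≢j ∘ cong suc

CM-replicate : ∀ n → CM (replicate n 1) ≅ K n
CM-replicate zero    = mk≅ (mk≅ᴿ ↔-refl (λ { {()} }) (λ { {()} }))
CM-replicate (suc n) = begin
  CM (1 ∷ replicate n 1)    ≅⟨ CM-cons 1 (replicate n 1) ⟩
  O 1 ∨G CM (replicate n 1) ≅⟨ ∨G-congʳ (O 1) (CM-replicate n) ⟩
  O 1 ∨G K n                ≅⟨ O₁∨K≅K n ⟩
  K (suc n)                 ∎
  where open ≅-Reasoning

-- CM [] has no vertices, so CM [] ∨G G is G on the nose.
CM-++ : ∀ xs ys → CM (xs ++ ys) ≅ (CM xs ∨G CM ys)
CM-++ []       ys = ≅-refl
CM-++ (x ∷ xs) ys = begin
  CM (x ∷ xs ++ ys)        ≅⟨ CM-cons x (xs ++ ys) ⟩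
  O x ∨G CM (xs ++ ys)     ≅⟨ ∨G-congʳ (O x) (CM-++ xs ys) ⟩
  O x ∨G (CM xs ∨G CM ys)  ≅⟨ ≅-sym (∨G-assoc (O x) (CM xs) (CM ys)) ⟩
  (O x ∨G CM xs) ∨G CM ys  ≅⟨ ∨G-congˡ (≅-sym (CM-cons x xs)) (CM ys) ⟩
  CM (x ∷ xs) ∨G CM ys     ∎
  where open ≅-Reasoning

CM-reverse : ∀ ps → CM (reverse ps) ≅ CM ps
CM-reverse []       = ≅-refl
CM-reverse (p ∷ ps) = begin
  CM (reverse (p ∷ ps))        ≅⟨ ≅-reflexive (cong CM (unfold-reverse p ps)) ⟩
  CM (reverse ps ++ [ p ])     ≅⟨ CM-++ (reverse ps) [ p ] ⟩
  CM (reverse ps) ∨G CM [ p ]  ≅⟨ ∨G-comm (CM (reverse ps)) (CM [ p ]) ⟩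
  CM [ p ] ∨G CM (reverse ps)  ≅⟨ ∨G-congʳ (CM [ p ]) (CM-reverse ps) ⟩
  CM [ p ] ∨G CM ps            ≅⟨ ≅-sym (CM-++ [ p ] ps) ⟩
  CM (p ∷ ps)                  ∎
  where open ≅-Reasoning

iterJoin≅CM∨K : ∀ ms n → iterJoin ms n ≅ (CM ms ∨G K n)
iterJoin≅CM∨K []       n = ≅-refl
iterJoin≅CM∨K (m ∷ ms) n = begin
  O m ∨G iterJoin ms n   ≅⟨ ∨G-congʳ (O m) (iterJoin≅CM∨K ms n) ⟩
  O m ∨G (CM ms ∨G K n)  ≅⟨ ≅-sym (∨G-assoc (O m) (CM ms) (K n)) ⟩
  (O m ∨G CM ms) ∨G K n  ≅⟨ ∨G-congˡ (≅-sym (CM-cons m ms)) (K n) ⟩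
  CM (m ∷ ms) ∨G K n     ∎
  where open ≅-Reasoning

Kmulti≅iterJoin : ∀ n ms → Kmulti n ms ≅ iterJoin ms n
Kmulti≅iterJoin n ms = begin
  CM (replicate n 1 ++ reverse ms)       ≅⟨ CM-++ (replicate n 1) (reverse ms) ⟩
  CM (replicate n 1) ∨G CM (reverse ms)  ≅⟨ ∨G-cong (CM-replicate n) (CM-reverse ms) ⟩
  K n ∨G CM ms                           ≅⟨ ∨G-comm (K n) (CM ms) ⟩
  CM ms ∨G K n                           ≅⟨ ≅-sym (iterJoin≅CM∨K ms n) ⟩
  iterJoin ms n                          ∎
  where open ≅-Reasoning

IsICColoring-cong : ∀ {G f g} → f ≗ g → IsICColoring G f → IsICColoring G g
IsICColoring-cong f≗g (f-positive , f-realises) = (λ v → subst (1 ≤_) (f≗g v) (f-positive v)) , λ k 1≤k k≤ →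
  let (S , S-connected , S-weight) = f-realises k 1≤k (subst (k ≤_) (sym (∑-cong f≗g)) k≤)
  in S , S-connected , trans (sym (∑-restrict-cong S f≗g)) S-weight

module _ {G H : Graph} (G≅H : G ≅ H) where
  open _≅_ G≅H

  pullback : Subset (N H) → Subset (N G)
  pullback T = tabulate (lookup T ∘ to)

  ∈-pullback⁺ : ∀ {T y} → y ∈ T → from y ∈ pullback T
  ∈-pullback⁺ {T} {y} y∈T = lookup⇒[]= (from y) (pullback T) (begin
    lookup (pullback T) (from y) ≡⟨ lookup∘tabulate (lookup T ∘ to) (from y) ⟩
    lookup T (to (from y))       ≡⟨ cong (lookup T) (strictlyInverseˡ y) ⟩
    lookup T y                   ≡⟨ []=⇒lookup y∈T ⟩
    true                         ∎)
    where open ≡-Reasoning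

  ∈-pullback⁻ : ∀ {T x} → x ∈ pullback T → to x ∈ T
  ∈-pullback⁻ {T} {x} x∈ =
    lookup⇒[]= (to x) T (trans (sym (lookup∘tabulate (lookup T ∘ to) x)) ([]=⇒lookup x∈))

  walk-pullback : ∀ {T y y′} → WalkIn H T y y′ → WalkIn G (pullback T) (from y) (from y′)
  walk-pullback (here y∈)      = here (∈-pullback⁺ y∈)
  walk-pullback (step y∈ a w) = step (∈-pullback⁺ y∈) (from-adj a) (walk-pullback w)

  connected-pullback : ∀ {T} → ConnectedInduced H T → ConnectedInduced G (pullback T)
  connected-pullback {T} ((y , y∈) , T-walk) = (from y , ∈-pullback⁺ y∈) , λ u v u∈ v∈ →
    subst₂ (WalkIn G (pullback T)) (strictlyInverseʳ u) (strictlyInverseʳ v)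
      (walk-pullback (T-walk (to u) (to v) (∈-pullback⁻ u∈) (∈-pullback⁻ v∈)))

  total-∘to : ∀ f → total G (f ∘ to) ≡ total H f
  total-∘to = ∑-↔ bijection

  weight-pullback : ∀ f T → weight G (f ∘ to) (pullback T) ≡ weight H f T
  weight-pullback f T = trans
    (∑-cong λ i → cong (if_then f (to i) else 0) (lookup∘tabulate (lookup T ∘ to) i))
    (∑-↔ bijection (restrict T f))

  IsICColoring-∘to : ∀ {f} → IsICColoring H f → IsICColoring G (f ∘ to)
  IsICColoring-∘to {f} (f-positive , f-realises) = f-positive ∘ to , λ k 1≤k k≤ →
    let (T , T-connected , T-weight) = f-realises k 1≤k (subst (k ≤_) (total-∘to f) k≤)
    in pullback T , connected-pullback T-connected , trans (weight-pullback f T) T-weight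

IsICIndex-≅ : ∀ {G H k} → G ≅ H → IsICIndex G k → IsICIndex H k
IsICIndex-≅ {k = k} G≅H ((f , f-IC , f-total) , f-maximal) =
  (f ∘ _≅_.from G≅H , IsICColoring-∘to (≅-sym G≅H) f-IC , trans (total-∘to (≅-sym G≅H) f) f-total) ,
  λ g g-IC → subst (_≤ k) (total-∘to G≅H g) (f-maximal _ (IsICColoring-∘to G≅H g-IC))

subsetCode : ∀ {n} → Subset n → Fin (2 ^ n)
subsetCode S = funToFin (Inverse.from Finₚ.2↔Bool ∘ lookup S)

lookup-subsetCode : ∀ {n} (S : Subset n) i → Inverse.to Finₚ.2↔Bool (finToFun (subsetCode S) i) ≡ lookup S i
lookup-subsetCode S i = trans (cong (Inverse.to Finₚ.2↔Bool) (Finₚ.finToFun-funToFin _ i))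
                              (Inverse.strictlyInverseˡ Finₚ.2↔Bool (lookup S i))

subsetCode-injective : ∀ {n} → Injective _≡_ _≡_ (subsetCode {n})
subsetCode-injective {x = S} {T} code≡ = begin
  S                   ≡⟨ tabulate∘lookup S ⟨
  tabulate (lookup S) ≡⟨ tabulate-cong lookupS≗lookupT ⟩
  tabulate (lookup T) ≡⟨ tabulate∘lookup T ⟩
  T                   ∎
  where
  open ≡-Reasoning
  lookupS≗lookupT : lookup S ≗ lookup T
  lookupS≗lookupT i = trans (sym (lookup-subsetCode S i))
    (trans (cong (λ c → Inverse.to Finₚ.2↔Bool (finToFun c i)) code≡) (lookup-subsetCode T i))

IC-total≤2^N : ∀ G {f} → IsICColoring G f → total G f ≤ 2 ^ N G
IC-total≤2^N G {f} (_ , f-realises) = ≮⇒≥ λ 2^N<total →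
  let (i , j , i<j , code≡) = Finₚ.pigeonhole 2^N<total (subsetCode ∘ realiser)
  in <-irrefl (suc-injective (begin
       suc (toℕ i)                 ≡⟨ realiser-weight i ⟨
       weight G f (realiser i)     ≡⟨ cong (weight G f) (subsetCode-injective {x = realiser i} {realiser j} code≡) ⟩
       weight G f (realiser j)     ≡⟨ realiser-weight j ⟩
       suc (toℕ j)                 ∎)) i<j
  where
  open ≡-Reasoning
  realiser : Fin (total G f) → Subset (N G)
  realiser i = proj₁ (f-realises (suc (toℕ i)) (s≤s z≤n) (Finₚ.toℕ<n i))
  realiser-weight : ∀ i → weight G f (realiser i) ≡ suc (toℕ i)
  realiser-weight i = proj₂ (proj₂ (f-realises (suc (toℕ i)) (s≤s z≤n) (Finₚ.toℕ<n i)))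

greatest : ∀ {P : ℕ → Set} → (∀ t → Dec (P t)) → ∀ c → (∀ {t} → P t → t ≤ c) →
  ∀ {t} → P t → ∃ λ k → P k × (∀ {t} → P t → t ≤ k)
greatest {P} P? zero    bounded Pt = 0 , subst P (n≤0⇒n≡0 (bounded Pt)) Pt , bounded
greatest {P} P? (suc c) bounded Pt with P? (suc c)
... | yes Pc = suc c , Pc , bounded
... | no ¬Pc = greatest P? c (λ Pt′ → ≤-pred (≤∧≢⇒< (bounded Pt′) λ { refl → ¬Pc Pt′ })) Pt

module _ (G : Graph) (connected? : ∀ S → Dec (ConnectedInduced G S)) where

  IsICColoring? : ∀ f → Dec (IsICColoring G f)
  IsICColoring? f =
    Finₚ.all? (λ v → 1 ≤? f v) ×-dec map′ from to (allUpTo? (λ j → realisable? (suc j)) (total G f))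
    where
    Realisable : ℕ → Set
    Realisable k = ∃ λ S → ConnectedInduced G S × weight G f S ≡ k
    realisable? : ∀ k → Dec (Realisable k)
    realisable? k = anySubset? λ S → connected? S ×-dec (weight G f S ≟ k)
    from : (∀ {j} → j < total G f → Realisable (suc j)) → ∀ k → 1 ≤ k → k ≤ total G f → Realisable k
    from realisable (suc j) _ k≤ = realisable k≤
    to : (∀ k → 1 ≤ k → k ≤ total G f → Realisable k) → ∀ {j} → j < total G f → Realisable (suc j)
    to realisable {j} j< = realisable (suc j) (s≤s z≤n) j<

  AttainedTotal : ℕ → Set
  AttainedTotal t = ∃ λ f → IsICColoring G f × total G f ≡ t

  -- A colouring of total t takes values ≤ t, so it is coded by an element of Fin (suc t ^ N G).
  AttainedTotal? : ∀ t → Dec (AttainedTotal t)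
  AttainedTotal? t = map′ (λ (c , c-IC , c-total) → decode c , c-IC , c-total) encode
    (Finₚ.any? λ c → IsICColoring? (decode c) ×-dec (total G (decode c) ≟ t))
    where
    decode : Fin (suc t ^ N G) → Fin (N G) → ℕ
    decode c = toℕ ∘ finToFun c
    encode : AttainedTotal t → ∃ λ c → IsICColoring G (decode c) × total G (decode c) ≡ t
    encode (f , f-IC , f-total) =
      funToFin code , IsICColoring-cong (sym ∘ decode-code) f-IC , trans (∑-cong decode-code) f-total
      where
      code : Fin (N G) → Fin (suc t)
      code i = fromℕ< (s≤s (≤-trans (f≤∑ f i) (≤-reflexive f-total)))
      decode-code : decode (funToFin code) ≗ f
      decode-code i = trans (cong toℕ (Finₚ.finToFun-funToFin code i)) (Finₚ.toℕ-fromℕ< _)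

  IC-index-exists : ∀ {f} → IsICColoring G f → ∃ λ k → IsICIndex G k × total G f ≤ k
  IC-index-exists {f} f-IC =
    let (k , k-attained , k-greatest) =
          greatest AttainedTotal? (2 ^ N G) (λ { (g , g-IC , refl) → IC-total≤2^N G g-IC }) (f , f-IC , refl)
    in k , (k-attained , λ g g-IC → k-greatest (g , g-IC , refl)) , k-greatest (f , f-IC , refl)

walk-head : ∀ {G S u v} → WalkIn G S u v → u ∈ S
walk-head (here u∈)    = u∈
walk-head (step u∈ _ _) = u∈

-- If non-adjacent vertices have the same neighbours, connected induced subgraphs have
-- diameter at most two, so connectivity is decided by a finite search.
module DiameterTwo (G : Graph) (adjacent? : ∀ u v → Dec (Adj G u v))
  (twins : ∀ {u v w} → ¬ Adj G u v → Adj G u w → Adj G w v) where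

  WithinTwoSteps : Subset (N G) → Fin (N G) → Fin (N G) → Set
  WithinTwoSteps S u v = u ≡ v ⊎ Adj G u v ⊎ ∃ λ w → w ∈ S × Adj G u w × Adj G w v

  shortcut : ∀ {S u v} → WalkIn G S u v → WithinTwoSteps S u v
  shortcut (here _) = inj₁ refl
  shortcut {u = u} {v} (step _ u~w w⇝v) with adjacent? u v
  ... | yes u~v = inj₂ (inj₁ u~v)
  ... | no  u≁v = inj₂ (inj₂ (_ , walk-head w⇝v , u~w , twins u≁v u~w))

  unshortcut : ∀ {S u v} → u ∈ S → v ∈ S → WithinTwoSteps S u v → WalkIn G S u v
  unshortcut u∈ v∈ (inj₁ refl)                       = here u∈
  unshortcut u∈ v∈ (inj₂ (inj₁ u~v))                 = step u∈ u~v (here v∈)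
  unshortcut u∈ v∈ (inj₂ (inj₂ (w , w∈ , u~w , w~v))) = step u∈ u~w (step w∈ w~v (here v∈))

  connected? : ∀ S → Dec (ConnectedInduced G S)
  connected? S = map′
    (λ (S-ne , within) → S-ne , λ u v u∈ v∈ → unshortcut u∈ v∈ (within u v u∈ v∈))
    (λ (S-ne , walk)   → S-ne , λ u v u∈ v∈ → shortcut (walk u v u∈ v∈))
    (nonempty? S ×-dec Finₚ.all? λ u → Finₚ.all? λ v → (u ∈? S) →-dec ((v ∈? S) →-dec within? u v))
    where
    within? : ∀ u v → Dec (WithinTwoSteps S u v)
    within? u v = (u Finₚ.≟ v) ⊎-dec adjacent? u v ⊎-dec
                  Finₚ.any? λ w → (w ∈? S) ×-dec adjacent? u w ×-dec adjacent? w v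

CM-connected? : ∀ ps S → Dec (ConnectedInduced (CM ps) S)
CM-connected? ps = DiameterTwo.connected? (CM ps) (λ u v → ¬? (partOf ps u ≟ partOf ps v)) twins
  where
  twins : ∀ {u v w} → ¬ (partOf ps u ≢ partOf ps v) → partOf ps u ≢ partOf ps w → partOf ps w ≢ partOf ps v
  twins {u} {v} ¬u≁v u≁w w≡v = u≁w (trans (decidable-stable (partOf ps u ≟ partOf ps v) ¬u≁v) (sym w≡v))

data Side (m n : ℕ) : Fin (m + n) → Set where
  left  : ∀ x → Side m n (x ↑ˡ n)
  right : ∀ y → Side m n (m ↑ʳ y)

side : ∀ m {n} (i : Fin (m + n)) → Side m n i
side m {n} i = subst (Side m n) (Finₚ.join-splitAt m n i) (fromSum (splitAt m i))
  where
  fromSum : ∀ s → Side m n (join m n s)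
  fromSum (inj₁ x) = left x
  fromSum (inj₂ y) = right y

∈-++⁺ʳ : ∀ {m n} (S : Subset m) {T : Subset n} {y} → y ∈ T → (m ↑ʳ y) ∈ S ++ᵛ T
∈-++⁺ʳ []      y∈T = y∈T
∈-++⁺ʳ (_ ∷ S) y∈T = there (∈-++⁺ʳ S y∈T)

∈-++⁻ʳ : ∀ {m n} (S : Subset m) {T : Subset n} {y} → (m ↑ʳ y) ∈ S ++ᵛ T → y ∈ T
∈-++⁻ʳ []      y∈T         = y∈T
∈-++⁻ʳ (_ ∷ S) (there y∈T) = ∈-++⁻ʳ S y∈T

module _ (G H : Graph) where

  ∨G-adjˡʳ : ∀ x y → Adj (G ∨G H) (x ↑ˡ N H) (N G ↑ʳ y)
  ∨G-adjˡʳ x y rewrite Finₚ.splitAt-↑ˡ (N G) x (N H) | Finₚ.splitAt-↑ʳ (N G) (N H) y = tt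

  ∨G-adjʳˡ : ∀ y x → Adj (G ∨G H) (N G ↑ʳ y) (x ↑ˡ N H)
  ∨G-adjʳˡ y x rewrite Finₚ.splitAt-↑ˡ (N G) x (N H) | Finₚ.splitAt-↑ʳ (N G) (N H) y = tt

  ∨G-adjʳʳ : ∀ {y y′} → Adj H y y′ → Adj (G ∨G H) (N G ↑ʳ y) (N G ↑ʳ y′)
  ∨G-adjʳʳ {y} {y′} a rewrite Finₚ.splitAt-↑ʳ (N G) (N H) y | Finₚ.splitAt-↑ʳ (N G) (N H) y′ = a

  walk-↑ʳ : ∀ S {T y y′} → WalkIn H T y y′ → WalkIn (G ∨G H) (S ++ᵛ T) (N G ↑ʳ y) (N G ↑ʳ y′)
  walk-↑ʳ S (here y∈)      = here (∈-++⁺ʳ S y∈)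
  walk-↑ʳ S (step y∈ a w) = step (∈-++⁺ʳ S y∈) (∨G-adjʳʳ a) (walk-↑ʳ S w)

  ∨G-connected : ∀ S {T} → ConnectedInduced H T → ConnectedInduced (G ∨G H) (S ++ᵛ T)
  ∨G-connected S {T} ((y₀ , y₀∈) , T-walk) = (N G ↑ʳ y₀ , ∈-++⁺ʳ S y₀∈) , walk
    where
    walk : ∀ u v → u ∈ S ++ᵛ T → v ∈ S ++ᵛ T → WalkIn (G ∨G H) (S ++ᵛ T) u v
    walk u v u∈ v∈ with side (N G) u | side (N G) v
    ... | left x  | left x′  = step u∈ (∨G-adjˡʳ x y₀) (step (∈-++⁺ʳ S y₀∈) (∨G-adjʳˡ y₀ x′) (here v∈))
    ... | left x  | right y  = step u∈ (∨G-adjˡʳ x y) (here v∈)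
    ... | right y | left x  = step u∈ (∨G-adjʳˡ y x) (here v∈)
    ... | right y | right y′ = walk-↑ʳ S (T-walk y y′ (∈-++⁻ʳ S u∈) (∈-++⁻ʳ S v∈))

⁅⁆-connected : ∀ G (i : Fin (N G)) → ConnectedInduced G ⁅ i ⁆
⁅⁆-connected G i = (i , x∈⁅x⁆ i) , walk
  where
  walk : ∀ u v → u ∈ ⁅ i ⁆ → v ∈ ⁅ i ⁆ → WalkIn G ⁅ i ⁆ u v
  walk u v u∈ v∈ rewrite x∈⁅y⁆⇒x≡y i u∈ | x∈⁅y⁆⇒x≡y i v∈ = here (x∈⁅x⁆ i)

K-connected : ∀ {n} {S : Subset n} → Nonempty S → ConnectedInduced (K n) S
K-connected {S = S} S-ne = S-ne , walk
  where
  walk : ∀ u v → u ∈ S → v ∈ S → WalkIn (K _) S u v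
  walk u v u∈ v∈ with u Finₚ.≟ v
  ... | yes refl = here u∈
  ... | no  u≢v  = step u∈ u≢v (here v∈)

K-IC : ∀ n → IsICColoring (K n) powersOfTwo
K-IC n = (λ i → m^n>0 2 (toℕ i)) , realise
  where
  realise : ∀ k → 1 ≤ k → k ≤ ∑ (powersOfTwo {n}) →
    ∃ λ S → ConnectedInduced (K n) S × weight (K n) powersOfTwo S ≡ k
  realise k 1≤k k≤∑ =
    let (S , ∑S≡k) = binary-expansion {n} k (subst (k <_) (suc-∑-powersOfTwo n) (s≤s k≤∑))
    in S , K-connected (0<∑-restrict⇒Nonempty S powersOfTwo (subst (0 <_) (sym ∑S≡k) 1≤k)) , ∑S≡k

K-total : ∀ n → total (K n) powersOfTwo ≡ 2 ^ n ∸ 1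
K-total n = cong (_∸ 1) (suc-∑-powersOfTwo n)

module JoinColouring {H : Graph} {g : Fin (N H) → ℕ} (g-IC : IsICColoring H g) (g-total>0 : 0 < total H g)
                     (m : ℕ) where

  private
    b : ℕ
    b = total H g
    G : Graph
    G = O (suc m) ∨G H
    instance
      b-nonZero : NonZero b
      b-nonZero = >-nonZero g-total>0

  colourO : Fin (suc m) → ℕ
  colourO zero    = 1
  colourO (suc j) = 2 * b * powersOfTwo j

  colour : Fin (N G) → ℕ
  colour = colourO ++ᶠ (λ h → 2 * g h)

  colour-positive : ∀ i → 1 ≤ colour i
  colour-positive i with splitAt (suc m) i
  ... | inj₁ zero    = ≤-refl
  ... | inj₁ (suc j) = *-mono-≤ {1} {2 * b} (*-mono-≤ {1} {2} (s≤s z≤n) g-total>0) (m^n>0 2 (toℕ j))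
  ... | inj₂ h       = *-mono-≤ {1} {2} (s≤s z≤n) (proj₁ g-IC h)

  colour-total : total G colour ≡ 2 ^ suc m * b + 1
  colour-total = begin
    ∑ (colourO ++ᶠ (λ h → 2 * g h))
      ≡⟨ ∑-++ᶠ colourO (λ h → 2 * g h) ⟩
    1 + ∑ (λ j → 2 * b * powersOfTwo {m} j) + ∑ (λ h → 2 * g h)
      ≡⟨ cong₂ (λ x y → 1 + x + y) (∑-*ˡ (2 * b) (powersOfTwo {m})) (∑-*ˡ 2 g) ⟩
    1 + 2 * b * ∑ (powersOfTwo {m}) + 2 * b
      ≡⟨ regroup b (∑ (powersOfTwo {m})) ⟩
    2 * b * suc (∑ (powersOfTwo {m})) + 1
      ≡⟨ cong (λ x → 2 * b * x + 1) (suc-∑-powersOfTwo m) ⟩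
    2 * b * 2 ^ m + 1
      ≡⟨ cong (_+ 1) (reorder b (2 ^ m)) ⟩
    2 * 2 ^ m * b + 1  ∎
    where
    open ≡-Reasoning
    regroup : ∀ b s → 1 + 2 * b * s + 2 * b ≡ 2 * b * (1 + s) + 1
    regroup = solve-∀
    reorder : ∀ b x → 2 * b * x ≡ 2 * x * b
    reorder = solve-∀

  colour-realises-large : ∀ ε q → bit ε + 2 * suc q ≤ 2 ^ suc m * b + 1 →
    ∃ λ S → ConnectedInduced G S × weight G colour S ≡ bit ε + 2 * suc q
  colour-realises-large ε q ≤total =
    let (T , T-connected , ∑T≡1+r) = proj₂ g-IC (suc r) (s≤s z≤n) (m%n<n q b)
        (S , ∑S≡s)                 = binary-expansion {m} s s<2^m
    in (ε ∷ S) ++ᵛ T , ∨G-connected (O (suc m)) H (ε ∷ S) T-connected , (begin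
      ∑ (restrict ((ε ∷ S) ++ᵛ T) colour)
        ≡⟨ ∑-restrict-++ (ε ∷ S) T colourO (λ h → 2 * g h) ⟩
      bit ε + ∑ (restrict S (λ j → 2 * b * powersOfTwo j)) + ∑ (restrict T (λ h → 2 * g h))
        ≡⟨ cong₂ (λ x y → bit ε + x + y)
             (trans (∑-restrict-*ˡ (2 * b) S powersOfTwo) (cong (2 * b *_) ∑S≡s))
             (trans (∑-restrict-*ˡ 2 T g) (cong (2 *_) ∑T≡1+r)) ⟩
      bit ε + 2 * b * s + 2 * suc r
        ≡⟨ regroup (bit ε) b s r ⟩
      bit ε + 2 * suc (r + s * b)
        ≡⟨ cong (λ x → bit ε + 2 * suc x) (m≡m%n+[m/n]*n q b) ⟨
      bit ε + 2 * suc q  ∎)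
    where
    open ≡-Reasoning
    r s : ℕ
    r = q % b
    s = q / b
    s<2^m : s < 2 ^ m
    s<2^m = m<n*o⇒m/o<n (halve-≤ ε (suc q) (2 ^ m * b)
              (subst (bit ε + 2 * suc q ≤_) (cong (_+ 1) (*-assoc 2 (2 ^ m) b)) ≤total))
    regroup : ∀ e b s r → e + 2 * b * s + 2 * (1 + r) ≡ e + 2 * (1 + (r + s * b))
    regroup = solve-∀

  colour-realises : ∀ k → 1 ≤ k → k ≤ 2 ^ suc m * b + 1 →
    ∃ λ S → ConnectedInduced G S × weight G colour S ≡ k
  colour-realises k 1≤k ≤total with halve k
  ... | false , zero  , refl = contradiction 1≤k λ ()
  ... | true  , zero  , refl =
    ⁅ zero ↑ˡ N H ⁆ , ⁅⁆-connected G (zero ↑ˡ N H) , ∑-restrict-⁅⁆ colour (zero ↑ˡ N H)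
  ... | ε     , suc q , refl = colour-realises-large ε q ≤total

  colour-IC : IsICColoring G colour
  colour-IC = colour-positive , λ k 1≤k k≤ → colour-realises k 1≤k (subst (k ≤_) colour-total k≤)

∨G-IC : ∀ {H g} → IsICColoring H g → 0 < total H g → ∀ m →
  ∃ λ f → IsICColoring (O (suc m) ∨G H) f × total (O (suc m) ∨G H) f ≡ 2 ^ suc m * total H g + 1
∨G-IC g-IC g-total>0 m = colour , colour-IC , colour-total
  where open JoinColouring g-IC g-total>0 m

bval-positive : ∀ n ms → 1 ≤ n → 0 < bval n ms
bval-positive (suc n) []       _ = subst (0 <_) (K-total (suc n)) (s≤s z≤n)
bval-positive n       (m ∷ ms) _ = m≤n+m 1 _

iterJoin-IC : ∀ n ms → 1 ≤ n → All (1 ≤_) ms →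
  ∃ λ f → IsICColoring (iterJoin ms n) f × total (iterJoin ms n) f ≡ bval n ms
iterJoin-IC n []           _   _          = powersOfTwo , K-IC n , K-total n
iterJoin-IC n (suc m ∷ ms) 1≤n (_ ∷ ms≥1) =
  let (g , g-IC , g-total) = iterJoin-IC n ms 1≤n ms≥1
      (f , f-IC , f-total) = ∨G-IC g-IC (subst (0 <_) (sym g-total) (bval-positive n ms 1≤n)) m
  in f , f-IC , trans f-total (cong (λ b → 2 ^ suc m * b + 1) g-total)

-- The lower bound holds for the m_i in any order and also for ℓ = 0.
corollary3p3 : (n : ℕ) → (ms : List ℕ) → 1 ≤ n → ms ≢ [] →
    Linked _≥_ ms → All (1 ≤_) ms →
    ∃ λ k → IsICIndex (Kmulti n ms) k × IsICIndex (iterJoin ms n) k × bval n ms ≤ k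
corollary3p3 n ms 1≤n _ _ ms≥1 =
  let (f , f-IC , f-total) = iterJoin-IC n ms 1≤n ms≥1
      K≅J                  = Kmulti≅iterJoin n ms
      (k , k-index , f≤k)  = IC-index-exists (Kmulti n ms) (CM-connected? (replicate n 1 ++ reverse ms))
                               (IsICColoring-∘to K≅J f-IC)
  in k , k-index , IsICIndex-≅ K≅J k-index , subst (_≤ k) (trans (total-∘to K≅J f) f-total) f≤k
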